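{- In the logic $\mathrm{FL}^B_{ew}$, for every set of formulas $\Gamma$ and formulas $\varphi,\psi$: $\Gamma,\varphi\vdash\psi$ if and only if $\Gamma\vdash B\varphi\to\psi$.
   Context: The logic $\mathrm{FL}^B_{ew}$ has binary connectives $\wedge,\vee,\cdot,\to$, constants $0,1$, and unary connective $B$; $\neg\varphi:=\varphi\to0$. Its axioms are all instances of: (1) $(\varphi\to\psi)\to((\psi\to\gamma)\to(\varphi\to\gamma))$; (2) $(\gamma\to\varphi)\to((\gamma\to\psi)\to(\gamma\to(\varphi\wedge\psi)))$; (3) $(\varphi\wedge\psi)\to\varphi$, $(\varphi\wedge\psi)\to\psi$; (4) $\varphi\to(\varphi\vee\psi)$, $\psi\to(\varphi\vee\psi)$; (5) $(\varphi\to\gamma)\to((\psi\to\gamma)\to((\varphi\vee\psi)\to\gamma))$; (6) $(\varphi\cdot\psi)\to(\psi\cdot\varphi)$; (7) $(\varphi\cdot\psi)\to\varphi$; (8) $(\varphi\to(\psi\to\gamma))\to((\varphi\cdot\psi)\to\gamma)$; (9) $((\varphi\cdot\psi)\to\gamma)\to(\varphi\to(\psi\to\gamma))$; (10) $0\to\varphi$, $\varphi\to1$; (B1) $B\varphi\to\varphi$; (B2) $B\varphi\vee\neg B\varphi$; (B3) $B(\varphi\vee\neg\varphi)\to(B\varphi\vee\neg\varphi)$; (B4) $B(\varphi\to\psi)\to(B\varphi\to B\psi)$. Its rules are modus ponens (from $\varphi$ and $\varphi\to\psi$ derive $\psi$) and rule (B) (from $\varphi$ derive $B\varphi$). $\Gamma\vdash\varphi$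 means there is a finite derivation of $\varphi$ from premises in $\Gamma$ using axioms and rules (rule (B) may be applied to any formula already derived, including premises); $\Gamma,\varphi$ denotes $\Gamma\cup\{\varphi\}$. -}

module Defs where

open import Data.Nat using (ℕ)
open import Data.Sum using (_⊎_)
open import Relation.Binary.PropositionalEquality using (_≡_)
open import Level using (0ℓ)

data Fm : Set where
  var  : ℕ → Fm
  _∧_  : Fm → Fm → Fm
  _∨_  : Fm → Fm → Fm
  _·_  : Fm → Fm → Fm
  _⇒_  : Fm → Fm → Fm
  𝟘    : Fm
  𝟙    : Fm
  B    : Fm → Fm

infixr 4 _⇒_
infixl 5 _∨_
infixl 6 _∧_
infixl 7 _·_

¬_ : Fm → Fm
¬ φ = φ ⇒ 𝟘

data Axiom : Fm → Set where
  ax1  : ∀ φ ψ γ → Axiom ((φ ⇒ ψ) ⇒ ((ψ ⇒ γ) ⇒ (φ ⇒ γ)))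
  ax2  : ∀ φ ψ γ → Axiom ((γ ⇒ φ) ⇒ ((γ ⇒ ψ) ⇒ (γ ⇒ (φ ∧ ψ))))
  ax3a : ∀ φ ψ → Axiom ((φ ∧ ψ) ⇒ φ)
  ax3b : ∀ φ ψ → Axiom ((φ ∧ ψ) ⇒ ψ)
  ax4a : ∀ φ ψ → Axiom (φ ⇒ (φ ∨ ψ))
  ax4b : ∀ φ ψ → Axiom (ψ ⇒ (φ ∨ ψ))
  ax5  : ∀ φ ψ γ → Axiom ((φ ⇒ γ) ⇒ ((ψ ⇒ γ) ⇒ ((φ ∨ ψ) ⇒ γ)))
  ax6  : ∀ φ ψ → Axiom ((φ · ψ) ⇒ (ψ · φ))
  ax7  : ∀ φ ψ → Axiom ((φ · ψ) ⇒ φ)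
  ax8  : ∀ φ ψ γ → Axiom ((φ ⇒ (ψ ⇒ γ)) ⇒ ((φ · ψ) ⇒ γ))
  ax9  : ∀ φ ψ γ → Axiom (((φ · ψ) ⇒ γ) ⇒ (φ ⇒ (ψ ⇒ γ)))
  ax10a : ∀ φ → Axiom (𝟘 ⇒ φ)
  ax10b : ∀ φ → Axiom (φ ⇒ 𝟙)
  axB1 : ∀ φ → Axiom (B φ ⇒ φ)
  axB2 : ∀ φ → Axiom (B φ ∨ ¬ B φ)
  axB3 : ∀ φ → Axiom (B (φ ∨ ¬ φ) ⇒ (B φ ∨ ¬ φ))
  axB4 : ∀ φ ψ → Axiom (B (φ ⇒ ψ) ⇒ (B φ ⇒ B ψ))

FmSet : Set₁
FmSet = Fm → Set

_,,_ : FmSet → Fm → FmSet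
(Γ ,, φ) χ = Γ χ ⊎ χ ≡ φ

infix 2 _⊢_
data _⊢_ (Γ : FmSet) : Fm → Set where
  prem : ∀ {φ} → Γ φ → Γ ⊢ φ
  axm  : ∀ {φ} → Axiom φ → Γ ⊢ φ
  mp   : ∀ {φ ψ} → Γ ⊢ φ → Γ ⊢ (φ ⇒ ψ) → Γ ⊢ ψ
  ruleB : ∀ {φ} → Γ ⊢ φ → Γ ⊢ B φ

-- The deduction theorem is proved by induction on derivations, replacing each
-- step χ by B φ ⇒ χ. The premise φ becomes axiom (B1). Modus ponens needs
-- contraction B φ ⇒ B φ · B φ, which holds because B φ is complemented by
-- (B2). Rule (B) is handled by (B4) together with B φ ⇒ B B φ, obtained from
-- (B3) applied to the necessitated instance B φ ∨ ¬ B φ of (B2).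
-- Conversely, Γ , φ derives B φ by rule (B), so modus ponens recovers ψ.
module Submission where

open import Defs
open import Data.Sum using (inj₁; inj₂)
open import Function.Bundles using (_⇔_; mk⇔)
open import Relation.Binary.PropositionalEquality using (refl)

⊢-mono : ∀ {Γ Δ ψ} → (∀ {χ} → Γ χ → Δ χ) → Γ ⊢ ψ → Δ ⊢ ψ
⊢-mono Γ⊆Δ (prem p)  = prem (Γ⊆Δ p)
⊢-mono Γ⊆Δ (axm a)   = axm a
⊢-mono Γ⊆Δ (mp d e)  = mp (⊢-mono Γ⊆Δ d) (⊢-mono Γ⊆Δ e)
⊢-mono Γ⊆Δ (ruleB d) = ruleB (⊢-mono Γ⊆Δ d)

module DerivedRules {Γ : FmSet} where

  ⇒-trans : ∀ {α β γ} → Γ ⊢ α ⇒ β → Γ ⊢ β ⇒ γ → Γ ⊢ α ⇒ γ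
  ⇒-trans {α} {β} {γ} αβ βγ = mp βγ (mp αβ (axm (ax1 α β γ)))

  ⇒-const : ∀ α β → Γ ⊢ α ⇒ (β ⇒ α)
  ⇒-const α β = mp (axm (ax7 α β)) (axm (ax9 α β α))

  curry : ∀ {α β γ} → Γ ⊢ α · β ⇒ γ → Γ ⊢ α ⇒ (β ⇒ γ)
  curry {α} {β} {γ} h = mp h (axm (ax9 α β γ))

  uncurry : ∀ {α β γ} → Γ ⊢ α ⇒ (β ⇒ γ) → Γ ⊢ α · β ⇒ γ
  uncurry {α} {β} {γ} h = mp h (axm (ax8 α β γ))

  ⇒-exchange : ∀ {α β γ} → Γ ⊢ α ⇒ (β ⇒ γ) → Γ ⊢ β ⇒ (α ⇒ γ)
  ⇒-exchange {α} {β} h = curry (⇒-trans (axm (ax6 β α)) (uncurry h))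

  ⇒-refl : ∀ α → Γ ⊢ α ⇒ α
  ⇒-refl α = mp (axm (ax10a 𝟘)) (⇒-exchange (⇒-const α (𝟘 ⇒ 𝟘)))

  ∨-elim : ∀ {α β γ} → Γ ⊢ α ⇒ γ → Γ ⊢ β ⇒ γ → Γ ⊢ α ∨ β ⇒ γ
  ∨-elim {α} {β} {γ} αγ βγ = mp βγ (mp αγ (axm (ax5 α β γ)))

  ¬-elim : ∀ α γ → Γ ⊢ ¬ α ⇒ (α ⇒ γ)
  ¬-elim α γ = curry (⇒-trans (uncurry (⇒-refl (¬ α))) (axm (ax10a γ)))

  complemented⇒contraction : ∀ {α} → Γ ⊢ α ∨ ¬ α → Γ ⊢ α ⇒ α · α
  complemented⇒contraction {α} α∨¬α =
    mp α∨¬α (∨-elim (curry (⇒-refl (α · α))) (¬-elim α (α · α)))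

  mp-under-contraction : ∀ {α β γ} → Γ ⊢ α ⇒ α · α →
                         Γ ⊢ α ⇒ β → Γ ⊢ α ⇒ (β ⇒ γ) → Γ ⊢ α ⇒ γ
  mp-under-contraction {α} {β} {γ} contraction αβ αβγ =
    ⇒-trans contraction (uncurry (⇒-trans αβγ (mp αβ (axm (ax1 α β γ)))))

  B-contraction : ∀ φ → Γ ⊢ B φ ⇒ B φ · B φ
  B-contraction φ = complemented⇒contraction (axm (axB2 φ))

  B-4 : ∀ φ → Γ ⊢ B φ ⇒ B (B φ)
  B-4 φ = mp (mp (ruleB (axm (axB2 φ))) (axm (axB3 (B φ))))
             (∨-elim (⇒-const (B (B φ)) (B φ)) (¬-elim (B φ) (B (B φ))))

open DerivedRules

deduction : ∀ {Γ φ ψ} → (Γ ,, φ) ⊢ ψ → Γ ⊢ B φ ⇒ ψ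
deduction         (prem (inj₁ p))    = mp (prem p) (⇒-const _ _)
deduction {φ = φ} (prem (inj₂ refl)) = axm (axB1 φ)
deduction         (axm a)            = mp (axm a) (⇒-const _ _)
deduction {φ = φ} (mp d e)           =
  mp-under-contraction (B-contraction φ) (deduction d) (deduction e)
deduction {φ = φ} (ruleB {χ} d)      =
  ⇒-trans (B-4 φ) (mp (ruleB (deduction d)) (axm (axB4 (B φ) χ)))

deduction⁻¹ : ∀ {Γ φ ψ} → Γ ⊢ B φ ⇒ ψ → (Γ ,, φ) ⊢ ψ
deduction⁻¹ h = mp (ruleB (prem (inj₂ refl))) (⊢-mono inj₁ h)

theorem3 : (Γ : FmSet) (φ ψ : Fm) → ((Γ ,, φ) ⊢ ψ) ⇔ (Γ ⊢ (B φ ⇒ ψ))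
theorem3 Γ φ ψ = mk⇔ deduction deduction⁻¹
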